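{- Let $n,k,f\ge1$ be integers, and assume the Erdős Girth Conjecture. Then there exists a simple graph $G$ with $n$ vertices and colored edges such that every $f$-ECFT $(2k-1)$-spanner of $G$ has $\Omega(\min\{fn^{1+1/k},n^2\})$ edges.
   Context: Erdős Girth Conjecture: for all integers $n,k\ge1$ there is an $n$-vertex graph of girth at least $2k+2$ with $\Omega(n^{1+1/k})$ edges. Edge colors are arbitrary. For a set $F$ of colors, $G-F$ deletes all edges whose color lies in $F$. A subgraph $H$ (inheriting colors) is an $f$-ECFT $t$-spanner of $G$ if for every set $F$ of at most $f$ colors, $\operatorname{dist}_{H-F}(u,v)\le t\cdot\operatorname{dist}_{G-F}(u,v)$ for all vertices $u,v$. -}

module Defs where

open import Data.Nat using (ℕ; zero; suc; _+_; _*_; _∸_; _^_; _≤_; _<_; _⊓_; _<?_)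
open import Data.Bool using (Bool; true; false; if_then_else_; _∧_)
open import Data.Maybe using (Maybe; just; nothing; is-just)
open import Data.Fin using (Fin; toℕ)
open import Data.List using (List; []; _∷_; _++_; [_]; length; map; allFin)
open import Data.Nat.ListAction using (sum)
open import Data.List.Membership.Propositional using (_∉_)
open import Data.List.Relation.Unary.Unique.Propositional using (Unique)
open import Data.Product using (Σ; _×_; ∃)
open import Data.Unit using (⊤)
open import Relation.Nullary using (does)
open import Relation.Binary.PropositionalEquality using (_≡_)

countPairs : {n : ℕ} → (Fin n → Fin n → Bool) → ℕ
countPairs {n} P =
  sum (map (λ i → sum (map (λ j → if does (toℕ i <? toℕ j) ∧ P i j then 1 else 0)
                            (allFin n)))
           (allFin n))

Graph : ℕ → Set
Graph n = Fin n → Fin n → Bool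

IsSimple : {n : ℕ} → Graph n → Set
IsSimple {n} G = (∀ u v → G u v ≡ G v u) × (∀ v → G v v ≡ false)

edges : {n : ℕ} → Graph n → ℕ
edges G = countPairs G

AdjChain : {n : ℕ} → Graph n → List (Fin n) → Set
AdjChain G [] = ⊤
AdjChain G (x ∷ []) = ⊤
AdjChain G (x ∷ y ∷ rest) = (G x y ≡ true) × AdjChain G (y ∷ rest)

-- x ∷ rest is a (simple) cycle x, r1, ..., r_m, x of length = length (x ∷ rest) ≥ 3
IsCycle : {n : ℕ} → Graph n → Fin n → List (Fin n) → Set
IsCycle G x rest =
  Unique (x ∷ rest) × (3 ≤ length (x ∷ rest)) × AdjChain G ((x ∷ rest) ++ [ x ])

GirthAtLeast : {n : ℕ} → Graph n → ℕ → Set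
GirthAtLeast {n} G g = ∀ (x : Fin n) (rest : List (Fin n)) → IsCycle G x rest → g ≤ length (x ∷ rest)

-- Edge-coloured simple graphs: nothing = no edge, just c = edge of colour c

CGraph : ℕ → Set
CGraph n = Fin n → Fin n → Maybe ℕ

IsSimpleC : {n : ℕ} → CGraph n → Set
IsSimpleC {n} G = (∀ u v → G u v ≡ G v u) × (∀ v → G v v ≡ nothing)

cedges : {n : ℕ} → CGraph n → ℕ
cedges G = countPairs (λ u v → is-just (G u v))

Subgraph : {n : ℕ} → CGraph n → CGraph n → Set
Subgraph {n} H G = ∀ (u v : Fin n) (c : ℕ) → H u v ≡ just c → G u v ≡ just c

-- adjacency in G - F
Avail : {n : ℕ} → CGraph n → List ℕ → Fin n → Fin n → Set
Avail G F u v = Σ ℕ (λ c → (G u v ≡ just c) × (c ∉ F))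

data Walk {n : ℕ} (R : Fin n → Fin n → Set) : Fin n → Fin n → ℕ → Set where
  nil  : ∀ {v} → Walk R v v 0
  cons : ∀ {u w v L} → R u w → Walk R w v L → Walk R u v (suc L)

-- dist_{H-F}(u,v) ≤ t · dist_{G-F}(u,v) for all F with |F| ≤ f, unfolded:
-- every u-v walk of length L in G-F yields a u-v walk of length ≤ t·L in H-F
-- (if u,v are disconnected in G-F the inequality holds trivially).
IsECFTSpanner : {n : ℕ} → ℕ → ℕ → CGraph n → CGraph n → Set
IsECFTSpanner {n} f t G H =
  IsSimpleC H × Subgraph H G ×
  (∀ (F : List ℕ) → length F ≤ f → ∀ (u v : Fin n) (L : ℕ) →
     Walk (Avail G F) u v L → ∃ (λ L' → Walk (Avail H F) u v L' × (L' ≤ t * L)))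

-- Erdős Girth Conjecture: for every k ≥ 1 there are a constant c = p/q > 0
-- and n₀ such that for all n ≥ n₀ there is an n-vertex simple graph of girth
-- ≥ 2k+2 with m ≥ c · n^{1+1/k} edges, i.e. p^k n^{k+1} ≤ q^k m^k.

ErdosGirthConjecture : Set
ErdosGirthConjecture =
  ∀ (k : ℕ) → 1 ≤ k →
  Σ ℕ λ p → Σ ℕ λ q → 1 ≤ p × 1 ≤ q × Σ ℕ λ n₀ →
  ∀ (n : ℕ) → n₀ ≤ n → 1 ≤ n →
  Σ (Graph n) λ G → IsSimple G × GirthAtLeast G (2 * k + 2) ×
    (p ^ k * n ^ (k + 1) ≤ q ^ k * edges G ^ k)

-- Let G₀ be an extremal graph of girth ≥ 2k+2 on N = ⌊n/2⌋ vertices and D ⊆ ℤ_N × ℤ_N its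
-- symmetric edge set. Pick f+1 translates of D greedily; by averaging, each new one covers at
-- least half of a fresh copy of D until half of ℤ_N × ℤ_N is covered, so together they cover
-- ≥ min((f+1)|D|, N²)/2 pairs. Join a ∈ [0,N) to N+b with colour i when (a,b) first lies in the
-- i-th translate. Undoing the translation maps colour class i into G₀ locally injectively, so it
-- has no closed non-backtracking walk shorter than 2k+2. If an f-ECFT (2k−1)-spanner missed an
-- edge uv of colour c, failing the other f colours would leave a u–v walk of colour c and length
-- ≤ 2k−1, closing with uv into such a walk of length ≤ 2k. So the spanner keeps all
-- ≥ min((f+1)|D|, N²)/2 edges of G, and |D| ≥ |E(G₀)| ≳ N^{1+1/k}.

module Submission where

open import Defs
open import Data.Nat
open import Data.Nat.Properties
open import Algebra.Properties.CommutativeSemigroup +-commutativeSemigroup using (xy∙z≈xz∙y) renaming (interchange to +-interchange)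
open import Algebra.Properties.CommutativeSemigroup *-commutativeSemigroup using (x∙yz≈y∙xz) renaming (interchange to *-interchange)
open import Data.Nat.DivMod
open import Data.Bool using (Bool; true; false; not; _∧_; _∨_; if_then_else_)
open import Data.Fin using (Fin; toℕ; zero; suc)
import Data.Fin.Properties as Fin
open import Data.Empty using (⊥-elim)
open import Data.List using (List; []; _∷_; _++_; [_]; length; filter; upTo; map; tabulate; allFin)
open import Data.List.Properties using (++-assoc; length-++; length-upTo; filter-notAll; map-tabulate)
open import Data.List.Membership.Propositional using (_∈_; _∉_)
open import Data.List.Membership.Propositional.Properties using (∈-upTo⁺; ∈-filter⁺; ∈-filter⁻)
open import Data.List.Relation.Unary.All using (All; []; _∷_)
import Data.List.Relation.Unary.All as All
import Data.List.Relation.Unary.All.Properties as All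
open import Data.List.Relation.Unary.Any using (here; there)
import Data.List.Relation.Unary.Any as Any
open import Data.List.Relation.Unary.Unique.Propositional using (Unique; []; _∷_)
import Data.List.Relation.Unary.Unique.DecPropositional as Unique
open import Data.Nat.ListAction using (sum)
open import Data.Nat.Tactic.RingSolver using (solve-∀)
open import Data.Maybe using (Maybe; just; nothing; is-just; _<∣>_)
import Data.Maybe as Maybe
open import Data.Product using (Σ; ∃; _×_; _,_; proj₁; proj₂)
open import Data.Sum using (_⊎_; inj₁; inj₂)
open import Data.Unit using (⊤; tt)
open import Function using (_∘_; id; case_of_)
open import Relation.Binary.PropositionalEquality hiding ([_])
open import Relation.Nullary using (Dec; yes; no; does; ¬_; ¬?; contradiction; _×-dec_)
open import Relation.Nullary.Decidable using (dec-true)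

-- Finite sums

∑< : ℕ → (ℕ → ℕ) → ℕ
∑< zero    g = 0
∑< (suc N) g = g 0 + ∑< N (g ∘ suc)

syntax ∑< N (λ i → e) = ∑[ i < N ] e

∑-cong : ∀ N {g h : ℕ → ℕ} → (∀ i → i < N → g i ≡ h i) → ∑< N g ≡ ∑< N h
∑-cong zero    eq = refl
∑-cong (suc N) eq = cong₂ _+_ (eq 0 z<s) (∑-cong N (λ i i<N → eq (suc i) (s<s i<N)))

∑-mono : ∀ N {g h : ℕ → ℕ} → (∀ i → i < N → g i ≤ h i) → ∑< N g ≤ ∑< N h
∑-mono zero    le = ≤-refl
∑-mono (suc N) le = +-mono-≤ (le 0 z<s) (∑-mono N (λ i i<N → le (suc i) (s<s i<N)))

∑-distrib-+ : ∀ N (g h : ℕ → ℕ) → ∑[ i < N ] (g i + h i) ≡ ∑< N g + ∑< N h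
∑-distrib-+ zero    g h = refl
∑-distrib-+ (suc N) g h = begin
  g 0 + h 0 + ∑[ i < N ] (g (suc i) + h (suc i))     ≡⟨ cong (g 0 + h 0 +_) (∑-distrib-+ N _ _) ⟩
  g 0 + h 0 + (∑< N (g ∘ suc) + ∑< N (h ∘ suc))     ≡⟨ +-interchange (g 0) (h 0) _ _ ⟩
  g 0 + ∑< N (g ∘ suc) + (h 0 + ∑< N (h ∘ suc))     ∎
  where open ≡-Reasoning

∑-*ˡ : ∀ N c (g : ℕ → ℕ) → ∑[ i < N ] (c * g i) ≡ c * ∑< N g
∑-*ˡ zero    c g = sym (*-zeroʳ c)
∑-*ˡ (suc N) c g = trans (cong (c * g 0 +_) (∑-*ˡ N c (g ∘ suc))) (sym (*-distribˡ-+ c (g 0) _))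

∑-*ʳ : ∀ N c (g : ℕ → ℕ) → ∑[ i < N ] (g i * c) ≡ ∑< N g * c
∑-*ʳ N c g = begin
  ∑[ i < N ] (g i * c)  ≡⟨ ∑-cong N (λ i _ → *-comm (g i) c) ⟩
  ∑[ i < N ] (c * g i)  ≡⟨ ∑-*ˡ N c g ⟩
  c * ∑< N g            ≡⟨ *-comm c _ ⟩
  ∑< N g * c            ∎
  where open ≡-Reasoning

∑-const : ∀ N c → ∑[ i < N ] c ≡ N * c
∑-const zero    c = refl
∑-const (suc N) c = cong (c +_) (∑-const N c)

∑-split : ∀ M N (g : ℕ → ℕ) → ∑< (M + N) g ≡ ∑< M g + ∑[ i < N ] g (M + i)
∑-split zero    N g = refl
∑-split (suc M) N g = trans (cong (g 0 +_) (∑-split M N (g ∘ suc))) (sym (+-assoc (g 0) _ _))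

∑-last : ∀ N (g : ℕ → ℕ) → ∑< (suc N) g ≡ ∑< N g + g N
∑-last N g = begin
  ∑< (suc N) g                ≡⟨ cong (λ m → ∑< m g) (+-comm 1 N) ⟩
  ∑< (N + 1) g                ≡⟨ ∑-split N 1 g ⟩
  ∑< N g + (g (N + 0) + 0)    ≡⟨ cong (∑< N g +_) (trans (+-identityʳ _) (cong g (+-identityʳ N))) ⟩
  ∑< N g + g N                ∎
  where open ≡-Reasoning

∑-swap : ∀ M N (g : ℕ → ℕ → ℕ) → ∑[ i < M ] ∑[ j < N ] g i j ≡ ∑[ j < N ] ∑[ i < M ] g i j
∑-swap zero    N g = sym (trans (∑-const N 0) (*-zeroʳ N))
∑-swap (suc M) N g = begin
  ∑[ j < N ] g 0 j + ∑[ i < M ] ∑[ j < N ] g (suc i) j  ≡⟨ cong (∑[ j < N ] g 0 j +_) (∑-swap M N (g ∘ suc)) ⟩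
  ∑[ j < N ] g 0 j + ∑[ j < N ] ∑[ i < M ] g (suc i) j  ≡⟨ sym (∑-distrib-+ N _ _) ⟩
  ∑[ j < N ] (g 0 j + ∑[ i < M ] g (suc i) j)           ∎
  where open ≡-Reasoning

∑-mono-range : ∀ {M N} (g : ℕ → ℕ) → M ≤ N → ∑< M g ≤ ∑< N g
∑-mono-range {M} g M≤N with o , refl ← m≤n⇒∃[o]m+o≡n M≤N =
  ≤-trans (m≤m+n (∑< M g) _) (≤-reflexive (sym (∑-split M o g)))

argmax : ∀ M (g : ℕ → ℕ) → Σ ℕ λ i → ∀ j → j < suc M → g j ≤ g i
argmax zero    g = 0 , λ { zero _ → ≤-refl ; (suc _) (s<s ()) }
argmax (suc M) g with i , max ← argmax M (g ∘ suc) | g 0 ≤? g (suc i)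
... | yes g0≤ = suc i , λ { zero _ → g0≤ ; (suc j) (s<s j<) → max j j< }
... | no  g0≰ = 0 , λ { zero _ → ≤-refl ; (suc j) (s<s j<) → ≤-trans (max j j<) (<⇒≤ (≰⇒> g0≰)) }

averaging : ∀ N .{{_ : NonZero N}} (g : ℕ → ℕ) → Σ ℕ λ i → ∑< N g ≤ N * g i
averaging (suc M) g with i , max ← argmax M g =
  i , ≤-trans (∑-mono (suc M) max) (≤-reflexive (∑-const (suc M) (g i)))

%-absorbˡ-+ : ∀ m n d .{{_ : NonZero d}} → (m % d + n) % d ≡ (m + n) % d
%-absorbˡ-+ m n d = begin
  (m % d + n) % d              ≡⟨ %-distribˡ-+ (m % d) n d ⟩
  (m % d % d + n % d) % d      ≡⟨ cong (λ r → (r + n % d) % d) (m%n%n≡m%n m d) ⟩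
  (m % d + n % d) % d          ≡⟨ sym (%-distribˡ-+ m n d) ⟩
  (m + n) % d                  ∎
  where open ≡-Reasoning

+-%-injectiveˡ : ∀ {a b} s d .{{_ : NonZero d}} → a < d → b < d → (a + s) % d ≡ (b + s) % d → a ≡ b
+-%-injectiveˡ {a} {b} s d a<d b<d eq = begin
  a                        ≡⟨ sym (m<n⇒m%n≡m a<d) ⟩
  a % d                    ≡⟨ sym ([m+kn]%n≡m%n a qb d) ⟩
  (a + qb * d) % d         ≡⟨ cong (_% d) (+-cancelʳ-≡ s _ _ shifted) ⟩
  (b + qa * d) % d         ≡⟨ [m+kn]%n≡m%n b qa d ⟩
  b % d                    ≡⟨ m<n⇒m%n≡m b<d ⟩
  b                        ∎
  where
  open ≡-Reasoning
  r  = (a + s) % d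
  qa = (a + s) / d
  qb = (b + s) / d
  shifted : a + qb * d + s ≡ b + qa * d + s
  shifted = begin
    a + qb * d + s                 ≡⟨ xy∙z≈xz∙y a (qb * d) s ⟩
    (a + s) + qb * d               ≡⟨ cong (_+ qb * d) (m≡m%n+[m/n]*n (a + s) d) ⟩
    r + qa * d + qb * d            ≡⟨ xy∙z≈xz∙y r (qa * d) (qb * d) ⟩
    r + qb * d + qa * d            ≡⟨ cong (λ r′ → r′ + qb * d + qa * d) eq ⟩
    (b + s) % d + qb * d + qa * d  ≡⟨ cong (_+ qa * d) (m≡m%n+[m/n]*n (b + s) d) ⟨
    (b + s) + qa * d               ≡⟨ xy∙z≈xz∙y b s (qa * d) ⟩
    b + qa * d + s                 ∎

∑-rotate : ∀ M (h : ℕ → ℕ) → ∑[ x < suc M ] h ((x + 1) % suc M) ≡ ∑< (suc M) h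
∑-rotate M h = begin
  ∑[ x < suc M ] h ((x + 1) % suc M)                    ≡⟨ ∑-last M _ ⟩
  ∑[ x < M ] h ((x + 1) % suc M) + h ((M + 1) % suc M)   ≡⟨ cong₂ _+_ (∑-cong M no-wrap) wrap ⟩
  ∑< M (h ∘ suc) + h 0                                   ≡⟨ +-comm _ (h 0) ⟩
  ∑< (suc M) h                                           ∎
  where
  open ≡-Reasoning
  no-wrap : ∀ x → x < M → h ((x + 1) % suc M) ≡ h (suc x)
  no-wrap x x<M = cong h (trans (m<n⇒m%n≡m (s<s (≤-trans (≤-reflexive (+-comm x 1)) x<M))) (+-comm x 1))
  wrap : h ((M + 1) % suc M) ≡ h 0
  wrap = cong h (trans (cong (_% suc M) (+-comm M 1)) (n%n≡0 (suc M)))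

∑-translate : ∀ N .{{_ : NonZero N}} a (h : ℕ → ℕ) → ∑[ x < N ] h ((x + a) % N) ≡ ∑< N h
∑-translate (suc M) zero    h = ∑-cong (suc M) λ x x<N → cong h (trans (cong (_% suc M) (+-identityʳ x)) (m<n⇒m%n≡m x<N))
∑-translate (suc M) (suc a) h = begin
  ∑[ x < N ] h ((x + suc a) % N)           ≡⟨ ∑-cong N (λ x _ → cong h (step x)) ⟩
  ∑[ x < N ] h (((x + 1) % N + a) % N)     ≡⟨ ∑-rotate M (λ y → h ((y + a) % N)) ⟩
  ∑[ y < N ] h ((y + a) % N)               ≡⟨ ∑-translate N a h ⟩
  ∑< N h                                   ∎
  where
  open ≡-Reasoning
  N = suc M
  step : ∀ x → (x + suc a) % N ≡ ((x + 1) % N + a) % N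
  step x = trans (cong (_% N) (sym (+-assoc x 1 a))) (sym (%-absorbˡ-+ (x + 1) a N))

-- Walks and girth

private variable
  n m : ℕ

Edge : Graph n → Fin n → Fin n → Set
Edge G u v = G u v ≡ true

Loopless : Graph n → Set
Loopless G = ∀ v → G v v ≡ false

NonBacktracking : {R : Fin n → Fin n → Set} {u v : Fin n} {L : ℕ} → Walk R u v L → Set
NonBacktracking (cons {u} _ (cons {w = w} r p)) = u ≢ w × NonBacktracking (cons r p)
NonBacktracking _                               = ⊤

NonBacktracking-tail : ∀ {R : Fin n → Fin n → Set} {u w v L} (r : R u w) (p : Walk R w v L) →
                       NonBacktracking (cons r p) → NonBacktracking p
NonBacktracking-tail r nil                _        = tt
NonBacktracking-tail r (cons r′ nil)      _        = tt
NonBacktracking-tail r (cons r′ (cons _ _)) (_ , nb) = nb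

NonBacktrackingWithin : (Fin n → Fin n → Set) → Fin n → Fin n → ℕ → Set
NonBacktrackingWithin R u v L = Σ ℕ λ L′ → L′ ≤ L × Σ (Walk R u v L′) NonBacktracking

cancellingCons : ∀ {R : Fin n → Fin n → Set} {x y v L} → R x y → (p : Walk R y v L) → NonBacktracking p →
                 NonBacktrackingWithin R x v (suc L)
cancellingCons r nil _ = 1 , ≤-refl , cons r nil , tt
cancellingCons {x = x} r (cons {w = z} {L = L} r′ p) nb with x Fin.≟ z
... | yes refl = L , m≤n⇒m≤1+n (n≤1+n L) , p , NonBacktracking-tail r′ p nb
... | no  x≢z  = _ , ≤-refl , cons r (cons r′ p) , x≢z , nb

removeBacktracking : ∀ {R : Fin n → Fin n → Set} {u v L} → Walk R u v L → NonBacktrackingWithin R u v L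
removeBacktracking nil = 0 , z≤n , nil , tt
removeBacktracking (cons r p) with _ , L′≤L , q , nb ← removeBacktracking p
                              with L″ , L″≤ , q′ , nb′ ← cancellingCons r q nb
  = L″ , ≤-trans L″≤ (s≤s L′≤L) , q′ , nb′

mapWalk : {R : Fin n → Fin n → Set} {S : Fin m → Fin m → Set} (π : Fin n → Fin m) →
          (∀ {x y} → R x y → S (π x) (π y)) → ∀ {u v L} → Walk R u v L → Walk S (π u) (π v) L
mapWalk π hom nil        = nil
mapWalk π hom (cons r p) = cons (hom r) (mapWalk π hom p)

LocallyInjective : (Fin n → Fin n → Set) → (Fin n → Fin m) → Set
LocallyInjective R π = ∀ {x y z} → R x y → R y z → π x ≡ π z → x ≡ z

mapWalk-nonBacktracking : {R : Fin n → Fin n → Set} {S : Fin m → Fin m → Set} →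
  (π : Fin n → Fin m)
  (hom : ∀ {x y} → R x y → S (π x) (π y)) → LocallyInjective R π →
  ∀ {u v L} (p : Walk R u v L) → NonBacktracking p → NonBacktracking (mapWalk {S = S} π hom p)
mapWalk-nonBacktracking π hom inj nil                     _          = tt
mapWalk-nonBacktracking π hom inj (cons r nil)            _          = tt
mapWalk-nonBacktracking π hom inj (cons r (cons r′ p)) (u≢w , nb) =
  (λ πu≡πw → u≢w (inj r r′ πu≡πw)) , mapWalk-nonBacktracking π hom inj (cons r′ p) nb

WalkGirthAtLeast : (Fin n → Fin n → Set) → ℕ → Set
WalkGirthAtLeast R g = ∀ {v L} (w : Walk R v v (suc L)) → NonBacktracking w → g ≤ suc L

WalkGirthAtLeast-weaken : ∀ {R : Fin n → Fin n → Set} {g g′} → g′ ≤ g → WalkGirthAtLeast R g → WalkGirthAtLeast R g′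
WalkGirthAtLeast-weaken g′≤g girth w nb = ≤-trans g′≤g (girth w nb)

walkGirth-pullback : {R : Fin n → Fin n → Set} {S : Fin m → Fin m → Set} →
  ∀ {g} (π : Fin n → Fin m) →
  (∀ {x y} → R x y → S (π x) (π y)) → LocallyInjective R π →
  WalkGirthAtLeast S g → WalkGirthAtLeast R g
walkGirth-pullback π hom inj girth w nb = girth (mapWalk π hom w) (mapWalk-nonBacktracking π hom inj w nb)

vertices : ∀ {R : Fin n → Fin n → Set} {u v L} → Walk R u v L → List (Fin n)
vertices {u = u} nil        = u ∷ []
vertices {u = u} (cons r p) = u ∷ vertices p

length-vertices : ∀ {R : Fin n → Fin n → Set} {u v L} (p : Walk R u v L) → length (vertices p) ≡ suc L
length-vertices nil        = refl
length-vertices (cons r p) = cong suc (length-vertices p)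

end∈vertices : ∀ {R : Fin n → Fin n → Set} {u v L} (p : Walk R u v L) → v ∈ vertices p
end∈vertices nil        = here refl
end∈vertices (cons r p) = there (end∈vertices p)

closedWalk-notUnique : ∀ {R : Fin n → Fin n → Set} {v L} (p : Walk R v v (suc L)) → ¬ Unique (vertices p)
closedWalk-notUnique (cons r p) (v∉p ∷ _) = All.lookup v∉p (end∈vertices p) refl

AdjChain-vertices : ∀ {G : Graph n} {u v L} (p : Walk (Edge G) u v L) → AdjChain G (vertices p)
AdjChain-vertices nil                 = tt
AdjChain-vertices (cons e nil)        = e , tt
AdjChain-vertices (cons e (cons e′ p)) = e , AdjChain-vertices (cons e′ p)

NoReturn : {A : Set} → List A → Set
NoReturn (x ∷ y ∷ z ∷ zs) = x ≢ z × NoReturn (y ∷ z ∷ zs)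
NoReturn _                = ⊤

NoReturn-vertices : ∀ {R : Fin n → Fin n → Set} {u v L} (p : Walk R u v L) → NonBacktracking p → NoReturn (vertices p)
NoReturn-vertices nil                          _          = tt
NoReturn-vertices (cons r nil)                 _          = tt
NoReturn-vertices (cons r (cons r′ nil))        (u≢w , _)  = u≢w , tt
NoReturn-vertices (cons r (cons r′ (cons r″ p))) (u≢w , nb) = u≢w , NoReturn-vertices (cons r′ (cons r″ p)) nb

NoReturn-tail : {A : Set} (y : A) (ys : List A) → NoReturn (y ∷ ys) → NoReturn ys
NoReturn-tail y []           _        = tt
NoReturn-tail y (z ∷ [])     _        = tt
NoReturn-tail y (z ∷ w ∷ ys) (_ , nr) = nr

AdjChain-tail : {G : Graph n} (y : Fin n) (ys : List (Fin n)) → AdjChain G (y ∷ ys) → AdjChain G ys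
AdjChain-tail y []       _       = tt
AdjChain-tail y (z ∷ ys) (_ , a) = a

AdjChain-++⁻ˡ : {G : Graph n} (xs : List (Fin n)) {ys : List (Fin n)} → AdjChain G (xs ++ ys) → AdjChain G xs
AdjChain-++⁻ˡ []           _       = tt
AdjChain-++⁻ˡ (x ∷ [])     _       = tt
AdjChain-++⁻ˡ (x ∷ y ∷ xs) (e , a) = e , AdjChain-++⁻ˡ (y ∷ xs) a

Unique-++⁻ˡ : {A : Set} (xs : List A) {ys : List A} → Unique (xs ++ ys) → Unique xs
Unique-++⁻ˡ []       _             = []
Unique-++⁻ˡ (x ∷ xs) (x∉ ∷ unique) = All.++⁻ˡ xs x∉ ∷ Unique-++⁻ˡ xs unique

splitAtFirst : (y : Fin n) (xs : List (Fin n)) →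
               All (y ≢_) xs ⊎ Σ (List (Fin n)) λ pre → Σ (List (Fin n)) λ post → xs ≡ pre ++ y ∷ post × All (y ≢_) pre
splitAtFirst y []       = inj₁ []
splitAtFirst y (x ∷ xs) with y Fin.≟ x
... | yes refl = inj₂ ([] , xs , refl , [])
... | no  y≢x with splitAtFirst y xs
...   | inj₁ y∉xs                   = inj₁ (y≢x ∷ y∉xs)
...   | inj₂ (pre , post , eq , y∉pre) = inj₂ (x ∷ pre , post , cong (x ∷_) eq , y≢x ∷ y∉pre)

-- The first repeated vertex closes a cycle: length 1 would be a loop, length 2 a return.
cycle-in-repeating : {G : Graph n} → Loopless G → (ys : List (Fin n)) → AdjChain G ys → NoReturn ys → ¬ Unique ys →
                     Σ (Fin n) λ x → Σ (List (Fin n)) λ rest → IsCycle G x rest × length (x ∷ rest) < length ys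
cycle-in-repeating loopless []       _   _  notUnique = ⊥-elim (notUnique [])
cycle-in-repeating {G = G} loopless (y ∷ ys) adj nr notUnique with Unique.unique? Fin._≟_ ys
... | no ys-notUnique =
  let x , rest , cyc , shorter = cycle-in-repeating loopless ys (AdjChain-tail y ys adj) (NoReturn-tail y ys nr) ys-notUnique
  in  x , rest , cyc , m<n⇒m<1+n shorter
... | yes ys-unique with splitAtFirst y ys
...   | inj₁ y∉ys = ⊥-elim (notUnique (y∉ys ∷ ys-unique))
...   | inj₂ (pre , post , refl , y∉pre) =
        y , pre , (y∉pre ∷ Unique-++⁻ˡ pre ys-unique , three≤ pre adj nr , closed) , s≤s shorter
  where
  three≤ : ∀ pre → AdjChain G (y ∷ pre ++ y ∷ post) → NoReturn (y ∷ pre ++ y ∷ post) → 3 ≤ length (y ∷ pre)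
  three≤ []          (loop , _) _          = contradiction (trans (sym loop) (loopless y)) λ ()
  three≤ (a ∷ [])    _          (y≢y , _)  = contradiction refl y≢y
  three≤ (a ∷ b ∷ _) _          _          = s≤s (s≤s (s≤s z≤n))
  closed : AdjChain G ((y ∷ pre) ++ [ y ])
  closed = AdjChain-++⁻ˡ (y ∷ pre ++ [ y ]) (subst (AdjChain G) (sym (++-assoc (y ∷ pre) [ y ] post)) adj)
  shorter : length pre < length (pre ++ y ∷ post)
  shorter = subst (length pre <_) (sym (length-++ pre)) (m<m+n (length pre) z<s)

girth⇒walkGirth : {G : Graph n} {g : ℕ} → Loopless G → GirthAtLeast G g → WalkGirthAtLeast (Edge G) g
girth⇒walkGirth loopless girth w nb
  with x , rest , cyc , shorter ← cycle-in-repeating loopless (vertices w) (AdjChain-vertices w) (NoReturn-vertices w nb) (closedWalk-notUnique w)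
  = ≤-trans (girth x rest cyc) (s≤s⁻¹ (subst (length (x ∷ rest) <_) (length-vertices w) shorter))

-- Covering ℤ_N × ℤ_N by translates

𝟙 : Bool → ℕ
𝟙 b = if b then 1 else 0

𝟙-∧ : ∀ a b → 𝟙 (a ∧ b) ≡ 𝟙 a * 𝟙 b
𝟙-∧ true  b = sym (+-identityʳ (𝟙 b))
𝟙-∧ false b = refl

𝟙-∨ : ∀ a b → 𝟙 (a ∨ b) ≡ 𝟙 b + 𝟙 (not b ∧ a)
𝟙-∨ true  true  = refl
𝟙-∨ true  false = refl
𝟙-∨ false true  = refl
𝟙-∨ false false = refl

𝟙-not : ∀ a → 𝟙 (not a) + 𝟙 a ≡ 1
𝟙-not true  = refl
𝟙-not false = refl

𝟙-mono : ∀ {a b} → (a ≡ true → b ≡ true) → 𝟙 a ≤ 𝟙 b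
𝟙-mono {false} _     = z≤n
𝟙-mono {true}  a⇒b rewrite a⇒b refl = ≤-refl

𝟙-∧-monoʳ : ∀ a {b c} → (b ≡ true → c ≡ true) → 𝟙 (a ∧ b) ≤ 𝟙 (a ∧ c)
𝟙-∧-monoʳ false _   = z≤n
𝟙-∧-monoʳ true  b⇒c = 𝟙-mono b⇒c

𝟙-∧-≤ʳ : ∀ a b → 𝟙 (a ∧ b) ≤ 𝟙 b
𝟙-∧-≤ʳ false b = z≤n
𝟙-∧-≤ʳ true  b = ≤-refl

m⊓n≤o<n⇒m≤o : ∀ {m n o} → m ⊓ n ≤ o → o < n → m ≤ o
m⊓n≤o<n⇒m≤o {m} {n} m⊓n≤o o<n with m ≤? n
... | yes m≤n = subst (_≤ _) (m≤n⇒m⊓n≡m m≤n) m⊓n≤o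
... | no  m≰n = contradiction (≤-<-trans (subst (_≤ _) (m≥n⇒m⊓n≡n (<⇒≤ (≰⇒> m≰n))) m⊓n≤o) o<n) (<-irrefl refl)

Shift : Set
Shift = ℕ × ℕ

-- D ⊆ ℤ_N × ℤ_N, encoded as an N-periodic relation on ℕ.
module Translates (N : ℕ) {{_ : NonZero N}} (D : ℕ → ℕ → Bool)
                  (D-periodicˡ : ∀ x y → D (x % N) y ≡ D x y)
                  (D-periodicʳ : ∀ x y → D x (y % N) ≡ D x y) where

  count : (ℕ → ℕ → Bool) → ℕ
  count P = ∑[ a < N ] ∑[ b < N ] 𝟙 (P a b)

  count-+ : ∀ (P Q R : ℕ → ℕ → Bool) → (∀ a b → 𝟙 (P a b) ≡ 𝟙 (Q a b) + 𝟙 (R a b)) →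
            count P ≡ count Q + count R
  count-+ P Q R split = trans (∑-cong N λ a _ → trans (∑-cong N λ b _ → split a b) (∑-distrib-+ N _ _)) (∑-distrib-+ N _ _)

  covers : Shift → ℕ → ℕ → Bool
  covers (α , β) a b = D (a + α) (b + β)

  firstCover : List Shift → ℕ → ℕ → Maybe ℕ
  firstCover []       a b = nothing
  firstCover (s ∷ ss) a b = if covers s a b then just 0 else Maybe.map suc (firstCover ss a b)

  shiftAt : List Shift → ℕ → Shift
  shiftAt []       _       = 0 , 0
  shiftAt (s ∷ ss) zero    = s
  shiftAt (s ∷ ss) (suc c) = shiftAt ss c

  firstCover-just : ∀ ss a b c → firstCover ss a b ≡ just c → c < length ss × covers (shiftAt ss c) a b ≡ true
  firstCover-just (s ∷ ss) a b c eq with covers s a b in covered-by-s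
  firstCover-just (s ∷ ss) a b .0 refl | true = z<s , covered-by-s
  ... | false with firstCover ss a b in first
  firstCover-just (s ∷ ss) a b .(suc c) refl | false | just c =
    let c<ss , cov = firstCover-just ss a b c first in s<s c<ss , cov

  covered : List Shift → ℕ → ℕ → Bool
  covered ss a b = is-just (firstCover ss a b)

  covered-∷ : ∀ s ss a b → covered (s ∷ ss) a b ≡ covers s a b ∨ covered ss a b
  covered-∷ s ss a b with covers s a b
  ... | true  = refl
  ... | false with firstCover ss a b
  ...   | just _  = refl
  ...   | nothing = refl

  uncovered : List Shift → ℕ
  uncovered ss = count (λ a b → not (covered ss a b))

  gain : List Shift → Shift → ℕ
  gain ss s = count (λ a b → not (covered ss a b) ∧ covers s a b)

  count-covered-∷ : ∀ s ss → count (covered (s ∷ ss)) ≡ count (covered ss) + gain ss s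
  count-covered-∷ s ss = count-+ _ _ _ λ a b → trans (cong 𝟙 (covered-∷ s ss a b)) (𝟙-∨ (covers s a b) (covered ss a b))

  uncovered+covered : ∀ ss → uncovered ss + count (covered ss) ≡ N * N
  uncovered+covered ss = begin
    uncovered ss + count (covered ss)   ≡⟨ count-+ (λ _ _ → true) _ _ (λ a b → sym (𝟙-not (covered ss a b))) ⟨
    ∑[ a < N ] ∑[ b < N ] 1            ≡⟨ ∑-cong N (λ a _ → ∑-const N 1) ⟩
    ∑[ a < N ] (N * 1)                 ≡⟨ ∑-const N (N * 1) ⟩
    N * (N * 1)                        ≡⟨ cong (N *_) (*-identityʳ N) ⟩
    N * N                              ∎
    where open ≡-Reasoning

  translates-through : ∀ a b → ∑[ α < N ] ∑[ β < N ] 𝟙 (covers (α , β) a b) ≡ count D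
  translates-through a b = begin
    ∑[ α < N ] ∑[ β < N ] 𝟙 (D (a + α) (b + β))       ≡⟨ ∑-cong N (λ α _ → ∑-cong N λ β _ → cong 𝟙 (columns α β)) ⟩
    ∑[ α < N ] ∑[ β < N ] 𝟙 (D (a + α) ((β + b) % N))
      ≡⟨ ∑-cong N (λ α _ → ∑-translate N b (λ y → 𝟙 (D (a + α) y))) ⟩
    ∑[ α < N ] row (a + α)                          ≡⟨ ∑-cong N (λ α _ → rows α) ⟩
    ∑[ α < N ] row ((α + a) % N)                    ≡⟨ ∑-translate N a row ⟩
    count D                                         ∎
    where
    open ≡-Reasoning
    row : ℕ → ℕ
    row x = ∑[ y < N ] 𝟙 (D x y)
    columns : ∀ α β → D (a + α) (b + β) ≡ D (a + α) ((β + b) % N)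
    columns α β = trans (cong (D (a + α)) (+-comm b β)) (sym (D-periodicʳ (a + α) (β + b)))
    rows : ∀ α → row (a + α) ≡ row ((α + a) % N)
    rows α = ∑-cong N λ y _ → cong 𝟙 (trans (cong (λ x → D x y) (+-comm a α)) (sym (D-periodicˡ (α + a) y)))

  -- Double counting: each uncovered pair lies in exactly count D translates.
  ∑-gain : ∀ ss → ∑[ α < N ] ∑[ β < N ] gain ss (α , β) ≡ uncovered ss * count D
  ∑-gain ss = begin
    ∑[ α < N ] ∑[ β < N ] ∑[ a < N ] ∑[ b < N ] f α β a b
      ≡⟨ ∑-cong N (λ α _ → ∑-swap N N λ β a → ∑[ b < N ] f α β a b) ⟩
    ∑[ α < N ] ∑[ a < N ] ∑[ β < N ] ∑[ b < N ] f α β a b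
      ≡⟨ ∑-swap N N (λ α a → ∑[ β < N ] ∑[ b < N ] f α β a b) ⟩
    ∑[ a < N ] ∑[ α < N ] ∑[ β < N ] ∑[ b < N ] f α β a b
      ≡⟨ ∑-cong N (λ a _ → ∑-cong N λ α _ → ∑-swap N N λ β b → f α β a b) ⟩
    ∑[ a < N ] ∑[ α < N ] ∑[ b < N ] ∑[ β < N ] f α β a b
      ≡⟨ ∑-cong N (λ a _ → ∑-swap N N λ α b → ∑[ β < N ] f α β a b) ⟩
    ∑[ a < N ] ∑[ b < N ] ∑[ α < N ] ∑[ β < N ] f α β a b
      ≡⟨ ∑-cong N (λ a _ → ∑-cong N λ b _ → per-pair a b) ⟩
    ∑[ a < N ] ∑[ b < N ] (𝟙 (not (covered ss a b)) * count D)
      ≡⟨ ∑-cong N (λ a _ → ∑-*ʳ N (count D) _) ⟩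
    ∑[ a < N ] (∑[ b < N ] 𝟙 (not (covered ss a b)) * count D)
      ≡⟨ ∑-*ʳ N (count D) _ ⟩
    uncovered ss * count D
      ∎
    where
    open ≡-Reasoning
    f : ℕ → ℕ → ℕ → ℕ → ℕ
    f α β a b = 𝟙 (not (covered ss a b) ∧ covers (α , β) a b)
    per-pair : ∀ a b → ∑[ α < N ] ∑[ β < N ] f α β a b ≡ 𝟙 (not (covered ss a b)) * count D
    per-pair a b = begin
      ∑[ α < N ] ∑[ β < N ] f α β a b                            ≡⟨ ∑-cong N (λ α _ → ∑-cong N λ β _ → 𝟙-∧ (not (covered ss a b)) _) ⟩
      ∑[ α < N ] ∑[ β < N ] (u * 𝟙 (covers (α , β) a b))         ≡⟨ ∑-cong N (λ α _ → ∑-*ˡ N u _) ⟩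
      ∑[ α < N ] (u * ∑[ β < N ] 𝟙 (covers (α , β) a b))         ≡⟨ ∑-*ˡ N u _ ⟩
      u * ∑[ α < N ] ∑[ β < N ] 𝟙 (covers (α , β) a b)           ≡⟨ cong (u *_) (translates-through a b) ⟩
      u * count D                                                ∎
      where u = 𝟙 (not (covered ss a b))

  bestShift : List Shift → Shift
  bestShift ss = α , β
    where
    α = proj₁ (averaging N λ α → ∑[ β < N ] gain ss (α , β))
    β = proj₁ (averaging N λ β → gain ss (α , β))

  bestShift-gain : ∀ ss → uncovered ss * count D ≤ N * (N * gain ss (bestShift ss))
  bestShift-gain ss = begin
    uncovered ss * count D                     ≡⟨ ∑-gain ss ⟨
    ∑[ α < N ] ∑[ β < N ] gain ss (α , β)      ≤⟨ proj₂ (averaging N λ α → ∑[ β < N ] gain ss (α , β)) ⟩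
    N * ∑[ β < N ] gain ss (α , β)             ≤⟨ *-monoʳ-≤ N (proj₂ (averaging N λ β → gain ss (α , β))) ⟩
    N * (N * gain ss (bestShift ss))           ∎
    where
    open ≤-Reasoning
    α = proj₁ (bestShift ss)

  greedy : ℕ → List Shift
  greedy zero    = []
  greedy (suc j) = bestShift (greedy j) ∷ greedy j

  length-greedy : ∀ j → length (greedy j) ≡ j
  length-greedy zero    = refl
  length-greedy (suc j) = cong suc (length-greedy j)

  bestShift-gain-large : ∀ ss → 2 * count (covered ss) < N * N → count D ≤ 2 * gain ss (bestShift ss)
  bestShift-gain-large ss half-uncovered = *-cancelˡ-≤ (N * N) (begin
    N * N * count D              ≤⟨ *-monoˡ-≤ (count D) mostly-uncovered ⟩
    2 * uncovered ss * count D   ≡⟨ *-assoc 2 (uncovered ss) (count D) ⟩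
    2 * (uncovered ss * count D) ≤⟨ *-monoʳ-≤ 2 (bestShift-gain ss) ⟩
    2 * (N * (N * g))            ≡⟨ cong (2 *_) (*-assoc N N g) ⟨
    2 * (N * N * g)              ≡⟨ x∙yz≈y∙xz 2 (N * N) g ⟩
    N * N * (2 * g)              ∎)
    where
    open ≤-Reasoning
    g = gain ss (bestShift ss)
    instance _ = m*n≢0 N N
    mostly-uncovered : N * N ≤ 2 * uncovered ss
    mostly-uncovered = +-cancelʳ-≤ (2 * count (covered ss)) (N * N) (2 * uncovered ss) (begin
      N * N + 2 * count (covered ss)    ≤⟨ +-monoʳ-≤ (N * N) (≤-trans (<⇒≤ half-uncovered) (m≤m+n (N * N) 0)) ⟩
      2 * (N * N)                       ≡⟨ cong (2 *_) (uncovered+covered ss) ⟨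
      2 * (uncovered ss + count (covered ss)) ≡⟨ *-distribˡ-+ 2 (uncovered ss) _ ⟩
      2 * uncovered ss + 2 * count (covered ss) ∎)

  greedy-covers : ∀ j → (j * count D) ⊓ (N * N) ≤ 2 * count (covered (greedy j))
  greedy-covers zero    = z≤n
  greedy-covers (suc j) with N * N ≤? 2 * count (covered (greedy j))
  ... | yes half-covered = begin
    (suc j * count D) ⊓ (N * N)     ≤⟨ m⊓n≤n _ _ ⟩
    N * N                          ≤⟨ half-covered ⟩
    2 * c                          ≤⟨ *-monoʳ-≤ 2 (m≤m+n c _) ⟩
    2 * (c + g)                    ≡⟨ cong (2 *_) (count-covered-∷ _ (greedy j)) ⟨
    2 * count (covered (greedy (suc j))) ∎
    where
    open ≤-Reasoning
    c = count (covered (greedy j))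
    g = gain (greedy j) (bestShift (greedy j))
  ... | no  half-uncovered = begin
    (suc j * count D) ⊓ (N * N)     ≤⟨ m⊓n≤m _ _ ⟩
    count D + j * count D          ≤⟨ +-mono-≤ (bestShift-gain-large (greedy j) (≰⇒> half-uncovered)) earlier ⟩
    2 * g + 2 * c                  ≡⟨ *-distribˡ-+ 2 g c ⟨
    2 * (g + c)                    ≡⟨ cong (2 *_) (trans (+-comm g c) (sym (count-covered-∷ _ (greedy j)))) ⟩
    2 * count (covered (greedy (suc j))) ∎
    where
    open ≤-Reasoning
    c = count (covered (greedy j))
    g = gain (greedy j) (bestShift (greedy j))
    earlier : j * count D ≤ 2 * c
    earlier = m⊓n≤o<n⇒m≤o (greedy-covers j) (≰⇒> half-uncovered)

  module CrossGraph (D-sym : ∀ x y → D x y ≡ D y x) (ss : List Shift) where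

    Cross : ℕ → ℕ → Set
    Cross x y = x < N × N ≤ y × y < N + N

    cross? : ∀ x y → Dec (Cross x y)
    cross? x y = x <? N ×-dec N ≤? y ×-dec y <? N + N

    Cross-asym : ∀ {x y} → Cross x y → ¬ Cross y x
    Cross-asym (x<N , _ , _) (_ , N≤x , _) = <⇒≱ x<N N≤x

    crossColour : ℕ → ℕ → Maybe ℕ
    crossColour x y with cross? x y
    ... | yes _ = firstCover ss x (y ∸ N)
    ... | no  _ = nothing

    crossColour-just : ∀ {x y c} → crossColour x y ≡ just c → Cross x y × firstCover ss x (y ∸ N) ≡ just c
    crossColour-just {x} {y} eq with cross? x y
    crossColour-just eq | yes cross = cross , eq

    crossColour-A : ∀ {x y c} → crossColour x y ≡ just c → x < N
    crossColour-A eq = proj₁ (proj₁ (crossColour-just eq))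

    crossColour-B : ∀ {x y c} → crossColour x y ≡ just c → N ≤ y
    crossColour-B eq = proj₁ (proj₂ (proj₁ (crossColour-just eq)))

    crossColour-cross : ∀ {x y} → Cross x y → crossColour x y ≡ firstCover ss x (y ∸ N)
    crossColour-cross {x} {y} cross with cross? x y
    ... | yes _     = refl
    ... | no  ¬cross = contradiction cross ¬cross

    crossColour-AB : ∀ {a b} → a < N → b < N → crossColour a (N + b) ≡ firstCover ss a b
    crossColour-AB {a} {b} a<N b<N =
      trans (crossColour-cross (a<N , m≤m+n N b , +-monoʳ-< N b<N)) (cong (firstCover ss a) (m+n∸m≡n N b))

    colour : ℕ → ℕ → Maybe ℕ
    colour x y = crossColour x y <∣> crossColour y x

    colour-just : ∀ {x y c} → colour x y ≡ just c → crossColour x y ≡ just c ⊎ crossColour y x ≡ just c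
    colour-just {x} {y} eq with crossColour x y
    ... | just _  = inj₁ eq
    ... | nothing = inj₂ eq

    colour-sym : ∀ x y → colour x y ≡ colour y x
    colour-sym x y with crossColour x y in xy | crossColour y x in yx
    ... | nothing | nothing = refl
    ... | just _  | nothing = refl
    ... | nothing | just _  = refl
    ... | just _  | just _  = ⊥-elim (Cross-asym (proj₁ (crossColour-just xy)) (proj₁ (crossColour-just yx)))

    colour-loopless : ∀ x → colour x x ≡ nothing
    colour-loopless x with crossColour x x in xx
    ... | nothing = refl
    ... | just _  = let cross = proj₁ (crossColour-just xx) in ⊥-elim (Cross-asym cross cross)

    colour-bound : ∀ {x y c} → colour x y ≡ just c → c < length ss
    colour-bound eq with colour-just eq
    ... | inj₁ xy = proj₁ (firstCover-just ss _ _ _ (proj₂ (crossColour-just xy)))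
    ... | inj₂ yx = proj₁ (firstCover-just ss _ _ _ (proj₂ (crossColour-just yx)))

    project : ℕ → ℕ → ℕ
    project c x with x <? N
    ... | yes _ = x + proj₁ (shiftAt ss c)
    ... | no  _ = x ∸ N + proj₂ (shiftAt ss c)

    project-A : ∀ c {x} → x < N → project c x ≡ x + proj₁ (shiftAt ss c)
    project-A c {x} x<N with x <? N
    ... | yes _   = refl
    ... | no  x≮N = contradiction x<N x≮N

    project-B : ∀ c {x} → N ≤ x → project c x ≡ x ∸ N + proj₂ (shiftAt ss c)
    project-B c {x} N≤x with x <? N
    ... | yes x<N = contradiction N≤x (<⇒≱ x<N)
    ... | no  _   = refl

    crossColour-hom : ∀ {x y c} → crossColour x y ≡ just c → D (project c x) (project c y) ≡ true
    crossColour-hom {x} {y} {c} eq with (x<N , N≤y , _) , first ← crossColour-just eq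
      rewrite project-A c x<N | project-B c N≤y = proj₂ (firstCover-just ss x (y ∸ N) c first)

    colour-hom : ∀ {x y c} → colour x y ≡ just c → D (project c x) (project c y) ≡ true
    colour-hom eq with colour-just eq
    ... | inj₁ xy = crossColour-hom xy
    ... | inj₂ yx = trans (D-sym _ _) (crossColour-hom yx)

    colour-locallyInjective : ∀ {x y z c} → colour x y ≡ just c → colour y z ≡ just c →
                              project c x % N ≡ project c z % N → x ≡ z
    colour-locallyInjective {x} {y} {z} {c} xy yz eq
      with colour-just xy | colour-just (trans (colour-sym z y) yz)
    ... | inj₁ xy′ | inj₁ zy′ =
      let (x<N , _) , _ = crossColour-just xy′ ; (z<N , _) , _ = crossColour-just zy′ in
      +-%-injectiveˡ _ N x<N z<N (subst₂ (λ s t → s % N ≡ t % N) (project-A c x<N) (project-A c z<N) eq)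
    ... | inj₂ yx′ | inj₂ yz′ =
      let (_ , N≤x , x<2N) , _ = crossColour-just yx′ ; (_ , N≤z , z<2N) , _ = crossColour-just yz′ in
      begin
        x          ≡⟨ m∸n+n≡m N≤x ⟨
        x ∸ N + N  ≡⟨ cong (_+ N) (+-%-injectiveˡ _ N (B-index N≤x x<2N) (B-index N≤z z<2N)
                        (subst₂ (λ s t → s % N ≡ t % N) (project-B c N≤x) (project-B c N≤z) eq)) ⟩
        z ∸ N + N  ≡⟨ m∸n+n≡m N≤z ⟩
        z          ∎
      where
      open ≡-Reasoning
      B-index : ∀ {w} → N ≤ w → w < N + N → w ∸ N < N
      B-index {w} N≤w w<2N = subst (w ∸ N <_) (m+n∸m≡n N N) (∸-monoˡ-< w<2N N≤w)
    ... | inj₁ xy′ | inj₂ yz′ = contradiction (crossColour-B xy′) (<⇒≱ (crossColour-A yz′))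
    ... | inj₂ yx′ | inj₁ zy′ = contradiction (crossColour-B zy′) (<⇒≱ (crossColour-A yx′))

-- Fault-tolerant spanners

ColourClass : CGraph n → ℕ → Fin n → Fin n → Set
ColourClass G c u v = G u v ≡ just c

allColoursBut : ℕ → ℕ → List ℕ
allColoursBut c f = filter (λ c′ → ¬? (c′ ≟ c)) (upTo (suc f))

length-allColoursBut : ∀ {c f} → c ≤ f → length (allColoursBut c f) ≤ f
length-allColoursBut {c} {f} c≤f = s≤s⁻¹ (subst (length (allColoursBut c f) <_) (length-upTo (suc f))
  (filter-notAll (λ c′ → ¬? (c′ ≟ c)) (upTo (suc f)) (Any.map (λ { refl c≢c → c≢c refl }) (∈-upTo⁺ (s≤s c≤f)))))

∉-allColoursBut : ∀ c f → c ∉ allColoursBut c f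
∉-allColoursBut c f c∈F = proj₂ (∈-filter⁻ (λ c′ → ¬? (c′ ≟ c)) {xs = upTo (suc f)} c∈F) refl

∈-allColoursBut : ∀ {c c′ f} → c′ ≤ f → c′ ≢ c → c′ ∈ allColoursBut c f
∈-allColoursBut {c} c′≤f c′≢c = ∈-filter⁺ (λ c″ → ¬? (c″ ≟ c)) (∈-upTo⁺ (s≤s c′≤f)) c′≢c

module _ {n f t : ℕ} {G H : CGraph n}
         (G-simple : IsSimpleC G)
         (colour≤f : ∀ {u v c} → G u v ≡ just c → c ≤ f)
         (classGirth : ∀ c → WalkGirthAtLeast (ColourClass G c) (2 + t))
         (spanner : IsECFTSpanner f t G H) where

  private
    H⊆G : Subgraph H G
    H⊆G = proj₁ (proj₂ spanner)

  closeUp : ∀ {u v c L} → H u v ≡ nothing → G v u ≡ just c → (p : Walk (ColourClass H c) u v L) → NonBacktracking p →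
            Σ (Walk (ColourClass G c) v v (suc L)) NonBacktracking
  closeUp _     vu nil              _  = cons vu nil , tt
  closeUp {u} {v} {c} no-uv vu (cons {w = w} uw p) nb =
    cons vu (cons (H⊆G u w c uw) (mapWalk id (λ {x} {y} → H⊆G x y c) p)) ,
    v≢w , mapWalk-nonBacktracking id (λ {x} {y} → H⊆G x y c) (λ _ _ eq → eq) (cons uw p) nb
    where
    v≢w : v ≢ w
    v≢w refl = case trans (sym no-uv) uw of λ ()

  colourDetour : ∀ {u v c} → G u v ≡ just c → Σ ℕ λ L → L ≤ t × Walk (ColourClass H c) u v L
  colourDetour {u} {v} {c} uv
    with L , W , L≤t*1 ← proj₂ (proj₂ spanner) (allColoursBut c f) (length-allColoursBut (colour≤f uv))
                           u v 1 (cons (c , uv , ∉-allColoursBut c f) nil)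
    = L , subst (L ≤_) (*-identityʳ t) L≤t*1 , mapWalk id only-c W
    where
    only-c : ∀ {x y} → Avail H (allColoursBut c f) x y → ColourClass H c x y
    only-c {x} {y} (c′ , xy , c′∉F) with c′ ≟ c
    ... | yes refl = xy
    ... | no  c′≢c = contradiction (∈-allColoursBut (colour≤f (H⊆G x y c′ xy)) c′≢c) c′∉F

  spanner-keeps-edges : ∀ {u v c} → G u v ≡ just c → ∃ λ c′ → H u v ≡ just c′
  spanner-keeps-edges {u} {v} {c} uv with H u v in H-uv
  ... | just c′ = c′ , refl
  ... | nothing
    with L , L≤t , detour ← colourDetour uv
    with L′ , L′≤L , shortcut , nb ← removeBacktracking detour
    with closed , closed-nb ← closeUp H-uv (trans (proj₁ G-simple v u) uv) shortcut nb
    = contradiction (classGirth c closed closed-nb) (<⇒≱ (s≤s (s≤s (≤-trans L′≤L L≤t))))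

-- Edge counts and the colouring construction

sum-map-mono : {A : Set} (xs : List A) {g h : A → ℕ} → (∀ x → g x ≤ h x) → sum (map g xs) ≤ sum (map h xs)
sum-map-mono []       g≤h = ≤-refl
sum-map-mono (x ∷ xs) g≤h = +-mono-≤ (g≤h x) (sum-map-mono xs g≤h)

sum-tabulate : ∀ m (h : Fin m → ℕ) {h′ : ℕ → ℕ} → (∀ i → h i ≡ h′ (toℕ i)) → sum (tabulate h) ≡ ∑< m h′
sum-tabulate zero    h eq = refl
sum-tabulate (suc m) h eq = cong₂ _+_ (eq zero) (sum-tabulate m (h ∘ suc) (eq ∘ suc))

sum-allFin : ∀ m (h : Fin m → ℕ) {h′ : ℕ → ℕ} → (∀ i → h i ≡ h′ (toℕ i)) →
             sum (map h (allFin m)) ≡ ∑< m h′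
sum-allFin m h eq = trans (cong sum (map-tabulate id h)) (sum-tabulate m h eq)

countPairs-∑ : ∀ {P : Fin n → Fin n → Bool} (P′ : ℕ → ℕ → Bool) → (∀ i j → P i j ≡ P′ (toℕ i) (toℕ j)) →
               countPairs P ≡ ∑[ x < n ] ∑[ y < n ] 𝟙 (does (x <? y) ∧ P′ x y)
countPairs-∑ {n} P′ eq = sum-allFin n _ λ i → sum-allFin n _ λ j → cong (λ b → 𝟙 (does (toℕ i <? toℕ j) ∧ b)) (eq i j)

countPairs-mono : ∀ {P Q : Fin n → Fin n → Bool} → (∀ i j → P i j ≡ true → Q i j ≡ true) → countPairs P ≤ countPairs Q
countPairs-mono {n} P⇒Q =
  sum-map-mono (allFin n) λ i → sum-map-mono (allFin n) λ j → 𝟙-∧-monoʳ (does (toℕ i <? toℕ j)) (P⇒Q i j)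

cedges-mono : ∀ {G H : CGraph n} → (∀ {u v c} → G u v ≡ just c → ∃ λ c′ → H u v ≡ just c′) → cedges G ≤ cedges H
cedges-mono {G = G} {H} G⇒H = countPairs-mono edge⇒edge
  where
  edge⇒edge : ∀ u v → is-just (G u v) ≡ true → is-just (H u v) ≡ true
  edge⇒edge u v G-uv with G u v in eq
  ... | just c with c′ , H-uv ← G⇒H eq rewrite H-uv = refl

is-just-<∣>ˡ : {A : Set} (x y : Maybe A) → is-just x ≡ true → is-just (x <∣> y) ≡ true
is-just-<∣>ˡ (just _) y _ = refl

module Construction {N : ℕ} {{_ : NonZero N}} (G₀ : Graph N) (G₀-simple : IsSimple G₀) (n f : ℕ) where

  toℕ-mod : ∀ x → toℕ (x mod N) ≡ x % N
  toℕ-mod x = Fin.toℕ-fromℕ< (m%n<n x N)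

  %-mod : ∀ x → (x % N) mod N ≡ x mod N
  %-mod x = Fin.toℕ-injective (trans (toℕ-mod (x % N)) (trans (m%n%n≡m%n x N) (sym (toℕ-mod x))))

  toℕ-mod-id : ∀ (i : Fin N) → toℕ i mod N ≡ i
  toℕ-mod-id i = Fin.toℕ-injective (trans (toℕ-mod (toℕ i)) (m<n⇒m%n≡m (Fin.toℕ<n i)))

  D : ℕ → ℕ → Bool
  D x y = G₀ (x mod N) (y mod N)

  open Translates N D (λ x y → cong (λ i → G₀ i (y mod N)) (%-mod x)) (λ x y → cong (G₀ (x mod N)) (%-mod y)) public

  shifts : List Shift
  shifts = greedy (suc f)

  open CrossGraph (λ x y → proj₁ G₀-simple (x mod N) (y mod N)) shifts public

  G : CGraph n
  G u v = colour (toℕ u) (toℕ v)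

  G-simple : IsSimpleC G
  G-simple = (λ u v → colour-sym (toℕ u) (toℕ v)) , (λ v → colour-loopless (toℕ v))

  G-colour≤f : ∀ {u v c} → G u v ≡ just c → c ≤ f
  G-colour≤f {c = c} uv = s≤s⁻¹ (subst (c <_) (length-greedy (suc f)) (colour-bound uv))

  G-classGirth : ∀ {g} → GirthAtLeast G₀ g → ∀ c → WalkGirthAtLeast (ColourClass G c) g
  G-classGirth girth c = walkGirth-pullback π colour-hom locallyInjective (girth⇒walkGirth (proj₂ G₀-simple) girth)
    where
    π : Fin n → Fin N
    π u = project c (toℕ u) mod N
    locallyInjective : LocallyInjective (ColourClass G c) π
    locallyInjective {x} {z = z} xy yz πx≡πz = Fin.toℕ-injective (colour-locallyInjective xy yz
      (trans (sym (toℕ-mod (project c (toℕ x)))) (trans (cong toℕ πx≡πz) (toℕ-mod (project c (toℕ z))))))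

  edges≤count : edges G₀ ≤ count D
  edges≤count = begin
    edges G₀                                           ≡⟨ countPairs-∑ D (λ i j → sym (cong₂ G₀ (toℕ-mod-id i) (toℕ-mod-id j))) ⟩
    ∑[ x < N ] ∑[ y < N ] 𝟙 (does (x <? y) ∧ D x y)   ≤⟨ ∑-mono N (λ x _ → ∑-mono N λ y _ → 𝟙-∧-≤ʳ _ (D x y)) ⟩
    count D                                            ∎
    where open ≤-Reasoning

  covered≤cedges : N + N ≤ n → count (covered shifts) ≤ cedges G
  covered≤cedges 2N≤n = begin
    count (covered shifts)                 ≤⟨ ∑-mono N (λ a a<N → ∑-mono N λ b b<N → 𝟙-mono (covered⇒edge a<N b<N)) ⟩
    ∑[ a < N ] ∑[ b < N ] e a (N + b)      ≤⟨ ∑-mono N (λ a _ → second-half (e a)) ⟩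
    ∑[ a < N ] ∑[ y < n ] e a y            ≤⟨ ∑-mono-range _ (≤-trans (m≤m+n N N) 2N≤n) ⟩
    ∑[ x < n ] ∑[ y < n ] e x y            ≡⟨ countPairs-∑ {P = λ u v → is-just (G u v)} (λ x y → is-just (colour x y)) (λ _ _ → refl) ⟨
    cedges G                               ∎
    where
    open ≤-Reasoning
    e : ℕ → ℕ → ℕ
    e x y = 𝟙 (does (x <? y) ∧ is-just (colour x y))
    second-half : ∀ g → ∑[ b < N ] g (N + b) ≤ ∑< n g
    second-half g = begin
      ∑[ b < N ] g (N + b)                ≤⟨ m≤n+m _ (∑< N g) ⟩
      ∑< N g + ∑[ b < N ] g (N + b)      ≡⟨ ∑-split N N g ⟨
      ∑< (N + N) g                        ≤⟨ ∑-mono-range g 2N≤n ⟩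
      ∑< n g                              ∎
    covered⇒edge : ∀ {a b} → a < N → b < N → covered shifts a b ≡ true →
                   does (a <? N + b) ∧ is-just (colour a (N + b)) ≡ true
    covered⇒edge {a} {b} a<N b<N cov rewrite dec-true (a <? N + b) (≤-trans a<N (m≤m+n N b)) =
      is-just-<∣>ˡ (crossColour a (N + b)) _ (trans (cong is-just (crossColour-AB a<N b<N)) cov)

^-distribʳ-* : ∀ a b k → (a * b) ^ k ≡ a ^ k * b ^ k
^-distribʳ-* a b zero    = refl
^-distribʳ-* a b (suc k) = trans (cong (a * b *_) (^-distribʳ-* a b k)) (*-interchange a b (a ^ k) (b ^ k))

3^[1+k]≤9^k : ∀ {k} → 1 ≤ k → 3 ^ (k + 1) ≤ 9 ^ k
3^[1+k]≤9^k {k} 1≤k = begin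
  3 ^ (k + 1)    ≡⟨ ^-distribˡ-+-* 3 k 1 ⟩
  3 ^ k * 3      ≤⟨ *-monoʳ-≤ (3 ^ k) (^-monoʳ-≤ 3 1≤k) ⟩
  3 ^ k * 3 ^ k  ≡⟨ ^-distribʳ-* 3 3 k ⟨
  9 ^ k          ∎
  where open ≤-Reasoning

sparse-bound : ∀ {k p q f n N E h} → 1 ≤ k → 1 ≤ p → n ≤ 3 * N →
               p ^ k * N ^ (k + 1) ≤ q ^ k * E ^ k → f * E ≤ 2 * h →
               p ^ k * (f ^ k * n ^ (k + 1)) ≤ (18 * p * q) ^ k * h ^ k
sparse-bound {k} {p} {q} {f} {n} {N} {E} {h} 1≤k 1≤p n≤3N many-edges fE≤2h = begin
  p ^ k * (f ^ k * n ^ (k + 1))                 ≤⟨ *-monoʳ-≤ (p ^ k) (*-monoʳ-≤ (f ^ k) (^-monoˡ-≤ (k + 1) n≤3N)) ⟩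
  p ^ k * (f ^ k * (3 * N) ^ (k + 1))           ≡⟨ cong (λ x → p ^ k * (f ^ k * x)) (^-distribʳ-* 3 N (k + 1)) ⟩
  p ^ k * (f ^ k * (3 ^ (k + 1) * N ^ (k + 1))) ≡⟨ regroup₁ (p ^ k) (f ^ k) (3 ^ (k + 1)) (N ^ (k + 1)) ⟩
  3 ^ (k + 1) * f ^ k * (p ^ k * N ^ (k + 1))   ≤⟨ *-monoʳ-≤ (3 ^ (k + 1) * f ^ k) many-edges ⟩
  3 ^ (k + 1) * f ^ k * (q ^ k * E ^ k)         ≡⟨ regroup₂ (3 ^ (k + 1)) (f ^ k) (q ^ k) (E ^ k) ⟩
  3 ^ (k + 1) * (q ^ k * (f ^ k * E ^ k))       ≡⟨ cong (λ x → 3 ^ (k + 1) * (q ^ k * x)) (^-distribʳ-* f E k) ⟨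
  3 ^ (k + 1) * (q ^ k * (f * E) ^ k)           ≡⟨ cong (3 ^ (k + 1) *_) (^-distribʳ-* q (f * E) k) ⟨
  3 ^ (k + 1) * (q * (f * E)) ^ k               ≤⟨ *-mono-≤ (3^[1+k]≤9^k 1≤k) (^-monoˡ-≤ k (*-monoʳ-≤ q fE≤2h)) ⟩
  9 ^ k * (q * (2 * h)) ^ k                     ≡⟨ ^-distribʳ-* 9 (q * (2 * h)) k ⟨
  (9 * (q * (2 * h))) ^ k                       ≤⟨ ^-monoˡ-≤ k (begin
      9 * (q * (2 * h))  ≡⟨ regroup₃ q h ⟩
      18 * 1 * q * h     ≤⟨ *-monoˡ-≤ h (*-monoˡ-≤ q (*-monoʳ-≤ 18 1≤p)) ⟩
      18 * p * q * h     ∎) ⟩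
  (18 * p * q * h) ^ k                          ≡⟨ ^-distribʳ-* (18 * p * q) h k ⟩
  (18 * p * q) ^ k * h ^ k                      ∎
  where
  open ≤-Reasoning
  regroup₁ : ∀ P F T M → P * (F * (T * M)) ≡ T * F * (P * M)
  regroup₁ = solve-∀
  regroup₂ : ∀ T F Q X → T * F * (Q * X) ≡ T * (Q * (F * X))
  regroup₂ = solve-∀
  regroup₃ : ∀ q h → 9 * (q * (2 * h)) ≡ 18 * 1 * q * h
  regroup₃ = solve-∀

dense-bound : ∀ {k p q n N h} → 1 ≤ q → n ≤ 3 * N → N * N ≤ 2 * h →
              p ^ k * n ^ (2 * k) ≤ (18 * p * q) ^ k * h ^ k
dense-bound {k} {p} {q} {n} {N} {h} 1≤q n≤3N NN≤2h = begin
  p ^ k * n ^ (2 * k)        ≡⟨ cong (p ^ k *_) (^-*-assoc n 2 k) ⟨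
  p ^ k * (n ^ 2) ^ k        ≡⟨ ^-distribʳ-* p (n ^ 2) k ⟨
  (p * n ^ 2) ^ k            ≤⟨ ^-monoˡ-≤ k (begin
      p * n ^ 2              ≤⟨ *-monoʳ-≤ p (^-monoˡ-≤ 2 n≤3N) ⟩
      p * (3 * N) ^ 2        ≡⟨ regroup₁ p N ⟩
      9 * p * (N * N)        ≤⟨ *-monoʳ-≤ (9 * p) NN≤2h ⟩
      9 * p * (2 * h)        ≡⟨ regroup₂ p h ⟩
      18 * p * 1 * h         ≤⟨ *-monoˡ-≤ h (*-monoʳ-≤ (18 * p) 1≤q) ⟩
      18 * p * q * h         ∎) ⟩
  (18 * p * q * h) ^ k       ≡⟨ ^-distribʳ-* (18 * p * q) h k ⟩
  (18 * p * q) ^ k * h ^ k   ∎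
  where
  open ≤-Reasoning
  regroup₁ : ∀ p N → p * (3 * N * (3 * N * 1)) ≡ 9 * p * (N * N)
  regroup₁ = solve-∀
  regroup₂ : ∀ p h → 9 * p * (2 * h) ≡ 18 * p * 1 * h
  regroup₂ = solve-∀

lower-bound-arithmetic :
  ∀ {k p q f n N E D h} → 1 ≤ k → 1 ≤ p → 1 ≤ q → n ≤ 3 * N →
  p ^ k * N ^ (k + 1) ≤ q ^ k * E ^ k → E ≤ D → (suc f * D) ⊓ (N * N) ≤ 2 * h →
  p ^ k * ((f ^ k * n ^ (k + 1)) ⊓ n ^ (2 * k)) ≤ (18 * p * q) ^ k * h ^ k
lower-bound-arithmetic {k} {p} {f = f} {N = N} {E} {D} {h} 1≤k 1≤p 1≤q n≤3N many-edges E≤D covering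
  with suc f * D ≤? N * N
... | yes sparse = ≤-trans (*-monoʳ-≤ (p ^ k) (m⊓n≤m _ _)) (sparse-bound 1≤k 1≤p n≤3N many-edges (begin
  f * E                       ≤⟨ *-monoʳ-≤ f E≤D ⟩
  f * D                       ≤⟨ m≤n+m (f * D) D ⟩
  suc f * D                   ≡⟨ m≤n⇒m⊓n≡m sparse ⟨
  (suc f * D) ⊓ (N * N)       ≤⟨ covering ⟩
  2 * h                       ∎))
  where open ≤-Reasoning
... | no  not-sparse = ≤-trans (*-monoʳ-≤ (p ^ k) (m⊓n≤n _ _))
  (dense-bound {k} {p} {N = N} {h} 1≤q n≤3N (subst (_≤ 2 * h) (m≥n⇒m⊓n≡n (<⇒≤ (≰⇒> not-sparse))) covering))

⌊n/2⌋-bounds : ∀ {m n} → suc m + suc m ≤ n → suc m ≤ ⌊ n /2⌋ × ⌊ n /2⌋ + ⌊ n /2⌋ ≤ n × n ≤ 3 * ⌊ n /2⌋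
⌊n/2⌋-bounds {m} {n} 2m≤n = m<N , 2N≤n , n≤3N
  where
  open ≤-Reasoning
  N = ⌊ n /2⌋
  m<N : suc m ≤ N
  m<N = subst (_≤ N) (sym (n≡⌊n+n/2⌋ (suc m))) (⌊n/2⌋-mono 2m≤n)
  2N≤n : N + N ≤ n
  2N≤n = begin
    N + N             ≤⟨ +-monoʳ-≤ N (⌊n/2⌋≤⌈n/2⌉ n) ⟩
    N + ⌈ n /2⌉       ≡⟨ ⌊n/2⌋+⌈n/2⌉≡n n ⟩
    n                 ∎
  n≤3N : n ≤ 3 * N
  n≤3N = begin
    n                 ≡⟨ ⌊n/2⌋+⌈n/2⌉≡n n ⟨
    N + ⌈ n /2⌉       ≤⟨ +-monoʳ-≤ N (⌊n/2⌋-mono (n≤1+n (suc n))) ⟩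
    N + suc N         ≤⟨ +-monoʳ-≤ N (+-monoˡ-≤ N (≤-trans (s≤s z≤n) m<N)) ⟩
    N + (N + N)       ≡⟨ cong (λ x → N + (N + x)) (+-identityʳ N) ⟨
    3 * N             ∎

spanner-lower-bound :
  ∀ {k p q N} {{_ : NonZero N}} (G₀ : Graph N) → 1 ≤ k → 1 ≤ p → 1 ≤ q →
  IsSimple G₀ → GirthAtLeast G₀ (2 * k + 2) → p ^ k * N ^ (k + 1) ≤ q ^ k * edges G₀ ^ k →
  ∀ f n → N + N ≤ n → n ≤ 3 * N →
  Σ (CGraph n) λ G → IsSimpleC G ×
    (∀ (H : CGraph n) → IsECFTSpanner f (2 * k ∸ 1) G H →
      p ^ k * ((f ^ k * n ^ (k + 1)) ⊓ n ^ (2 * k)) ≤ (18 * p * q) ^ k * cedges H ^ k)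
spanner-lower-bound {k} {p} {q} {N} G₀ 1≤k 1≤p 1≤q G₀-simple G₀-girth G₀-dense f n 2N≤n n≤3N =
  G , G-simple , λ H spanner →
    lower-bound-arithmetic 1≤k 1≤p 1≤q n≤3N G₀-dense edges≤count (covering H spanner)
  where
  open Construction G₀ G₀-simple n f
  classGirth : ∀ c → WalkGirthAtLeast (ColourClass G c) (2 + (2 * k ∸ 1))
  classGirth = WalkGirthAtLeast-weaken (≤-trans (+-monoʳ-≤ 2 (m∸n≤m (2 * k) 1)) (≤-reflexive (+-comm 2 (2 * k))))
             ∘ G-classGirth G₀-girth
  covering : ∀ H → IsECFTSpanner f (2 * k ∸ 1) G H → (suc f * count D) ⊓ (N * N) ≤ 2 * cedges H
  covering H spanner = begin
    (suc f * count D) ⊓ (N * N)   ≤⟨ greedy-covers (suc f) ⟩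
    2 * count (covered shifts)    ≤⟨ *-monoʳ-≤ 2 (covered≤cedges 2N≤n) ⟩
    2 * cedges G                  ≤⟨ *-monoʳ-≤ 2 (cedges-mono {G = G} {H} (spanner-keeps-edges G-simple G-colour≤f classGirth spanner)) ⟩
    2 * cedges H                  ∎
    where open ≤-Reasoning

theorem4p2 : ErdosGirthConjecture →
    ∀ (k : ℕ) → 1 ≤ k →
    Σ ℕ λ p → Σ ℕ λ q → 1 ≤ p × 1 ≤ q × Σ ℕ λ n₀ →
    ∀ (f n : ℕ) → 1 ≤ f → 1 ≤ n → n₀ ≤ n →
    Σ (CGraph n) λ G → IsSimpleC G ×
      (∀ (H : CGraph n) → IsECFTSpanner f (2 * k ∸ 1) G H →
        p ^ k * ((f ^ k * n ^ (k + 1)) ⊓ n ^ (2 * k)) ≤ q ^ k * cedges H ^ k)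
theorem4p2 egc k 1≤k with p , q , 1≤p , 1≤q , n₀ , dense-graphs ← egc k 1≤k =
  p , 18 * p * q , 1≤p , *-mono-≤ {1} {18 * p} (*-mono-≤ {1} {18} (s≤s z≤n) 1≤p) 1≤q ,
  suc n₀ + suc n₀ , λ f n _ _ n₀≤n →
    let n₀<N , 2N≤n , n≤3N = ⌊n/2⌋-bounds n₀≤n
        1≤N = ≤-trans (s≤s z≤n) n₀<N
        instance _ = >-nonZero 1≤N
        G₀ , G₀-simple , G₀-girth , G₀-dense = dense-graphs ⌊ n /2⌋ (<⇒≤ n₀<N) 1≤N
    in  spanner-lower-bound G₀ 1≤k 1≤p 1≤q G₀-simple G₀-girth G₀-dense f n 2N≤n n≤3N
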